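{- Let $G$ be a $d$-regular graph on $n$ vertices and let $S\subseteq V(G)$. Then $\mathrm{sp}(G)\ge \frac12\left(\frac{|S|^2}{2}\frac{d}{n}-e_G(S)\right)$.
   Context: All graphs are finite and simple; $e_G(S)$ is the number of edges of $G$ with both endpoints in $S$. $\mathrm{mc}(G)$ denotes the maximum number of edges crossing a partition of $V(G)$ into two parts, and $\mathrm{sp}(G)=\mathrm{mc}(G)-e(G)/2$. -}

module Defs where

open import Data.Nat using (ℕ; zero; suc; _+_; _*_; _⊔_)
open import Data.Bool using (Bool; true; false; _∧_; not; if_then_else_)
open import Data.Fin using (Fin)
open import Data.Fin.Subset using (Subset; _∈_; ∣_∣)
import Data.Integer
open import Data.Vec using (Vec; []; _∷_)
open import Data.List using (List; []; _∷_; map; _++_; foldr; allFin)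
open import Data.Nat.ListAction using (sum)
open import Relation.Binary.PropositionalEquality using (_≡_)

record Graph (n : ℕ) : Set where
  field
    adj   : Fin n → Fin n → Bool
    sym   : ∀ u v → adj u v ≡ adj v u
    irrefl : ∀ v → adj v v ≡ false
open Graph public

b2n : Bool → ℕ
b2n true  = 1
b2n false = 0

deg : ∀ {n} → Graph n → Fin n → ℕ
deg G u = sum (map (λ v → b2n (adj G u v)) (allFin _))

Regular : ∀ {n} → ℕ → Graph n → Set
Regular d G = ∀ v → deg G v ≡ d

inS : ∀ {n} → Subset n → Fin n → Bool
inS S i = Data.Vec.lookup S i

ordPairs : ∀ {n} → Graph n → (Fin n → Bool) → (Fin n → Bool) → ℕ
ordPairs G p q =
  sum (map (λ u → sum (map (λ v → b2n (p u ∧ q v ∧ adj G u v)) (allFin _))) (allFin _))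

-- 2 · e_G(S): ordered adjacent pairs inside S (each edge counted twice)
twiceEdgesIn : ∀ {n} → Graph n → Subset n → ℕ
twiceEdgesIn G S = ordPairs G (inS S) (inS S)

twiceEdges : ∀ {n} → Graph n → ℕ
twiceEdges G = ordPairs G (λ _ → true) (λ _ → true)

cut : ∀ {n} → Graph n → Subset n → ℕ
cut G T = ordPairs G (inS T) (λ v → not (inS T v))

allSubsets : (n : ℕ) → List (Subset n)
allSubsets zero    = [] ∷ []
allSubsets (suc n) = map (true ∷_) (allSubsets n) ++ map (false ∷_) (allSubsets n)

mc : ∀ {n} → Graph n → ℕ
mc {n} G = foldr (λ T m → cut G T ⊔ m) 0 (allSubsets n)

-- 4 · sp(G) = 4 · mc(G) − 2 · e(G), as an integer
fourSp : ∀ {n} → Graph n → Data.Integer.ℤ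
fourSp G = Data.Integer._-_ (Data.Integer.+_ (4 * mc G)) (Data.Integer.+_ (twiceEdges G))

-- Put each vertex v into T independently with probability p v / N. Then N² times the expected
-- number of edges leaving T is Φ N p = Σ_{u,v} A u v · p u · (N − p v), and since G has no
-- loops Φ N is affine in every single coordinate p w. So rounding the coordinates one at a time
-- to 0 or N, always towards the larger value (conditional expectations), ends in an actual cut
-- T with N² · mc(G) ≥ N² · cut(T) ≥ Φ N p. With N = 2n, s = |S| and probability (2n − s)/2n on S,
-- (n − s)/2n off S, d-regularity evaluates Φ to n³d + nds² − n² · 2e(S), which is the claim.
module Submission where

open import Defs hiding (sym)
open import Data.Nat using (ℕ; NonZero)
open import Data.Fin.Subset using (Subset; ∣_∣)
open import Data.Integer using (ℤ; +_; _-_; _*_; _≤_)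

open import Data.Bool using (Bool; true; false; _∧_; not)
open import Data.Fin using (Fin; zero; suc; _≟_)
open import Data.Fin.Subset.Properties using (∣p∣≤n)
open import Data.Integer using (_+_; -_; 0ℤ; 1ℤ; +≤+; Positive; NonNegative; nonNegative; _≤?_)
open import Data.Integer.Properties
  using (≤-refl; ≤-trans; ≤-reflexive; module ≤-Reasoning; <⇒≤; ≰⇒>; positive⁻¹; i≤j⇒0≤j-i; i-j≤i;
         +-mono-≤; +-monoˡ-≤; +-monoʳ-≤; *-monoˡ-≤-nonNeg; *-cancelˡ-≤-pos;
         +-identityˡ; +-identityʳ; +-inverseʳ; *-identityʳ; *-zeroʳ; *-comm; pos-+; pos-*)
open import Algebra.Properties.Semiring.Sum Data.Integer.Properties.+-*-semiring
  using (sum-syntax; sum-cong-≗; ∑-distrib-+; ∑-comm; *-distribˡ-sum)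
open import Data.Integer.Tactic.RingSolver using (solve-∀)
open import Data.List using (List; []; _∷_; map; foldr; foldl; allFin; tabulate)
open import Data.List.Properties using (map-tabulate; map-cong)
open import Data.List.Membership.Propositional using (_∈_)
open import Data.List.Membership.Propositional.Properties using (∈-allFin; ∈-++⁺ˡ; ∈-++⁺ʳ; ∈-map⁺)
open import Data.List.Relation.Unary.Any using (here; there)
import Data.Nat as Nat
import Data.Nat.Properties as Nat
open import Data.Nat.ListAction using (sum)
open import Data.Product using (_×_; _,_; proj₁; proj₂; ∃-syntax)
open import Data.Vec using ([]; _∷_)
import Data.Vec as Vec
import Data.Vec.Properties as Vec
open import Data.Vec.Functional using (Vector; updateAt)
open import Data.Vec.Functional.Properties using (updateAt-updates; updateAt-minimal)
open import Function using (_∘_; const)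
open import Relation.Binary.PropositionalEquality
  using (_≡_; _≢_; _≗_; refl; sym; trans; cong; cong₂; subst; module ≡-Reasoning)
open import Relation.Nullary using (Dec; yes; no; does)

∑-linear : ∀ {m} a b (f g : Vector ℤ m) →
  ∑[ i < m ] (a * f i + b * g i) ≡ a * ∑[ i < m ] f i + b * ∑[ i < m ] g i
∑-linear a b f g = trans (∑-distrib-+ (λ i → a * f i) (λ i → b * g i))
                         (sym (cong₂ _+_ (*-distribˡ-sum a f) (*-distribˡ-sum b g)))

∑∑-linear : ∀ {k m} a b (f g : Fin k → Fin m → ℤ) →
  ∑[ u < k ] ∑[ v < m ] (a * f u v + b * g u v) ≡
  a * ∑[ u < k ] ∑[ v < m ] f u v + b * ∑[ u < k ] ∑[ v < m ] g u v
∑∑-linear {m = m} a b f g =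
  trans (sum-cong-≗ (λ u → ∑-linear a b (f u) (g u)))
        (∑-linear a b (λ u → ∑[ v < m ] f u v) (λ u → ∑[ v < m ] g u v))

∑∑-distribˡ : ∀ {k m} c (f : Fin k → Fin m → ℤ) →
  c * ∑[ u < k ] ∑[ v < m ] f u v ≡ ∑[ u < k ] ∑[ v < m ] (c * f u v)
∑∑-distribˡ {m = m} c f =
  trans (*-distribˡ-sum c (λ u → ∑[ v < m ] f u v)) (sum-cong-≗ (λ u → *-distribˡ-sum c (f u)))

∑-ones : ∀ m → ∑[ i < m ] 1ℤ ≡ + m
∑-ones Nat.zero    = refl
∑-ones (Nat.suc m) = cong (_+_ 1ℤ) (∑-ones m)

∑-count : ∀ {m} (S : Subset m) → ∑[ i < m ] (+ b2n (inS S i)) ≡ + ∣ S ∣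
∑-count []          = refl
∑-count (true ∷ S)  = cong (_+_ 1ℤ) (∑-count S)
∑-count (false ∷ S) = trans (+-identityˡ _) (∑-count S)

sum-tabulate : ∀ m (f : Fin m → ℕ) → + sum (tabulate f) ≡ ∑[ i < m ] (+ f i)
sum-tabulate Nat.zero    f = refl
sum-tabulate (Nat.suc m) f = trans (pos-+ (f zero) _) (cong (_+_ (+ f zero)) (sum-tabulate m (f ∘ suc)))

sum-allFin : ∀ m (f : Fin m → ℕ) → + sum (map f (allFin m)) ≡ ∑[ i < m ] (+ f i)
sum-allFin m f = trans (cong (λ xs → + sum xs) (map-tabulate (λ i → i) f)) (sum-tabulate m f)

≤-foldr-⊔ : ∀ {A : Set} (f : A → ℕ) {xs x} → x ∈ xs → f x Nat.≤ foldr (λ y m → f y Nat.⊔ m) 0 xs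
≤-foldr-⊔ f {y ∷ _} (here refl) = Nat.m≤m⊔n (f y) _
≤-foldr-⊔ f {y ∷ _} (there x∈xs) = Nat.≤-trans (≤-foldr-⊔ f x∈xs) (Nat.m≤n⊔m (f y) _)

∈-allSubsets : ∀ {n} (T : Subset n) → T ∈ allSubsets n
∈-allSubsets []          = here refl
∈-allSubsets (true ∷ T)  = ∈-++⁺ˡ (∈-map⁺ (true ∷_) (∈-allSubsets T))
∈-allSubsets (false ∷ T) = ∈-++⁺ʳ _ (∈-map⁺ (false ∷_) (∈-allSubsets T))

cut≤mc : ∀ {n} (G : Graph n) (T : Subset n) → cut G T Nat.≤ mc G
cut≤mc G T = ≤-foldr-⊔ (cut G) (∈-allSubsets T)

ordPairs-cong : ∀ {n} (G : Graph n) {p p′ q q′ : Fin n → Bool} → p ≗ p′ → q ≗ q′ →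
  ordPairs G p q ≡ ordPairs G p′ q′
ordPairs-cong G p≗p′ q≗q′ =
  cong sum (map-cong (λ u → cong sum (map-cong (λ v →
    cong₂ (λ x y → b2n (x ∧ y ∧ adj G u v)) (p≗p′ u) (q≗q′ v)) (allFin _))) (allFin _))

ordPairs-complement≤mc : ∀ {n} (G : Graph n) (b : Fin n → Bool) → ordPairs G b (not ∘ b) Nat.≤ mc G
ordPairs-complement≤mc G b = subst (Nat._≤ mc G) cut-tabulate (cut≤mc G (Vec.tabulate b))
  where
  cut-tabulate : cut G (Vec.tabulate b) ≡ ordPairs G b (not ∘ b)
  cut-tabulate = ordPairs-cong G (Vec.lookup∘tabulate b) (cong not ∘ Vec.lookup∘tabulate b)

-- Rounding a point of the box [0, N]ⁿ to a corner

_[_]≔_ : ∀ {n} → Vector ℤ n → Fin n → ℤ → Vector ℤ n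
p [ w ]≔ a = updateAt p w (const a)

[]≔-updates : ∀ {n} (p : Vector ℤ n) w a → (p [ w ]≔ a) w ≡ a
[]≔-updates p w a = updateAt-updates w p

[]≔-minimal : ∀ {n} (p : Vector ℤ n) w a {v} → v ≢ w → (p [ w ]≔ a) v ≡ p v
[]≔-minimal p w a {v} = updateAt-minimal v w p

[]≔-preserves : ∀ {n} (P : ℤ → Set) (p : Vector ℤ n) w a v → P a → P (p v) → P ((p [ w ]≔ a) v)
[]≔-preserves P p w a v Pa Ppv with v ≟ w
... | yes refl = subst P (sym ([]≔-updates p v a)) Pa
... | no v≢w   = subst P (sym ([]≔-minimal p w a v≢w)) Ppv

corner : ℤ → Bool → ℤ
corner N true  = N
corner N false = 0ℤ

InInterval : ℤ → ℤ → Set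
InInterval N x = 0ℤ ≤ x × x ≤ N

corner-inInterval : ∀ {N} → 0ℤ ≤ N → ∀ b → InInterval N (corner N b)
corner-inInterval 0≤N true  = 0≤N , ≤-refl
corner-inInterval 0≤N false = ≤-refl , 0≤N

combination≤ʳ : ∀ {N t x y} → t ≤ N → x ≤ y → t * y + (N - t) * x ≤ N * y
combination≤ʳ {N} {t} {x} {y} t≤N x≤y = begin
  t * y + (N - t) * x
    ≤⟨ +-monoʳ-≤ (t * y) (*-monoˡ-≤-nonNeg (N - t) ⦃ nonNegative (i≤j⇒0≤j-i t≤N) ⦄ x≤y) ⟩
  t * y + (N - t) * y  ≡⟨ recombine t y N ⟩
  N * y                ∎
  where
  open ≤-Reasoning
  recombine : ∀ t y N → t * y + (N - t) * y ≡ N * y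
  recombine = solve-∀

combination≤ˡ : ∀ {N t x y} → 0ℤ ≤ t → y ≤ x → t * y + (N - t) * x ≤ N * x
combination≤ˡ {N} {t} {x} {y} 0≤t y≤x = begin
  t * y + (N - t) * x  ≤⟨ +-monoˡ-≤ ((N - t) * x) (*-monoˡ-≤-nonNeg t ⦃ nonNegative 0≤t ⦄ y≤x) ⟩
  t * x + (N - t) * x  ≡⟨ recombine t x N ⟩
  N * x                ∎
  where
  open ≤-Reasoning
  recombine : ∀ t x N → t * x + (N - t) * x ≡ N * x
  recombine = solve-∀

InBox : ∀ {n} → ℤ → Vector ℤ n → Set
InBox N p = ∀ v → InInterval N (p v)

positive⇒0≤ : ∀ N ⦃ _ : Positive N ⦄ → 0ℤ ≤ N
positive⇒0≤ N = <⇒≤ (positive⁻¹ N)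

module Rounding {n : ℕ} (N : ℤ) ⦃ _ : Positive N ⦄ (F : Vector ℤ n → ℤ)
  (F-cong : ∀ {p q} → p ≗ q → F p ≡ F q)
  (F-affine : ∀ p w → N * F p ≡ p w * F (p [ w ]≔ N) + (N - p w) * F (p [ w ]≔ 0ℤ))
  where

  AtCorner : Vector ℤ n → Fin n → Set
  AtCorner p v = ∃[ b ] p v ≡ corner N b

  roundAt : Vector ℤ n → Fin n → Vector ℤ n
  roundAt p w = p [ w ]≔ corner N (does (F (p [ w ]≔ 0ℤ) ≤? F (p [ w ]≔ N)))

  roundAt-≥ : ∀ p w → InBox N p → F p ≤ F (roundAt p w)
  roundAt-≥ p w box = *-cancelˡ-≤-pos _ _ N
    (≤-trans (≤-reflexive (F-affine p w)) (pick (F (p [ w ]≔ 0ℤ) ≤? F (p [ w ]≔ N))))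
    where
    pick : (d : Dec (F (p [ w ]≔ 0ℤ) ≤ F (p [ w ]≔ N))) →
      p w * F (p [ w ]≔ N) + (N - p w) * F (p [ w ]≔ 0ℤ) ≤ N * F (p [ w ]≔ corner N (does d))
    pick (yes F₀≤F₁) = combination≤ʳ (proj₂ (box w)) F₀≤F₁
    pick (no  F₀≰F₁) = combination≤ˡ {N} (proj₁ (box w)) (<⇒≤ (≰⇒> F₀≰F₁))

  roundAt-inBox : ∀ p w → InBox N p → InBox N (roundAt p w)
  roundAt-inBox p w box v = []≔-preserves (InInterval N) p w _ v (corner-inInterval (positive⇒0≤ N) _) (box v)

  roundAt-atCorner : ∀ p w → AtCorner (roundAt p w) w
  roundAt-atCorner p w = _ , []≔-updates p w _

  roundAt-preserves : ∀ p w v → AtCorner p v → AtCorner (roundAt p w) v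
  roundAt-preserves p w v = []≔-preserves (λ x → ∃[ b ] x ≡ corner N b) p w _ v (_ , refl)

  roundAll : Vector ℤ n → List (Fin n) → Vector ℤ n
  roundAll = foldl roundAt

  roundAll-≥ : ∀ p ws → InBox N p → F p ≤ F (roundAll p ws)
  roundAll-≥ p []       box = ≤-refl
  roundAll-≥ p (w ∷ ws) box =
    ≤-trans (roundAt-≥ p w box) (roundAll-≥ (roundAt p w) ws (roundAt-inBox p w box))

  roundAll-preserves : ∀ p ws v → AtCorner p v → AtCorner (roundAll p ws) v
  roundAll-preserves p []       v c = c
  roundAll-preserves p (w ∷ ws) v c = roundAll-preserves (roundAt p w) ws v (roundAt-preserves p w v c)

  roundAll-atCorner : ∀ p ws v → v ∈ ws → AtCorner (roundAll p ws) v
  roundAll-atCorner p (v ∷ ws) v (here refl) = roundAll-preserves (roundAt p v) ws v (roundAt-atCorner p v)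
  roundAll-atCorner p (w ∷ ws) v (there v∈ws) = roundAll-atCorner (roundAt p w) ws v v∈ws

  ∃corner≥ : ∀ p → InBox N p → ∃[ b ] F p ≤ F (corner N ∘ b)
  ∃corner≥ p box =
    proj₁ ∘ rounded , ≤-trans (roundAll-≥ p (allFin n) box) (≤-reflexive (F-cong (proj₂ ∘ rounded)))
    where
    rounded : ∀ v → AtCorner (roundAll p (allFin n)) v
    rounded v = roundAll-atCorner p (allFin n) v (∈-allFin v)

-- The bilinear form of the adjacency matrix

b2n-∧ : ∀ x y z → + b2n z * + b2n x * + b2n y ≡ + b2n (x ∧ y ∧ z)
b2n-∧ true  true  true  = refl
b2n-∧ true  true  false = refl
b2n-∧ true  false true  = refl
b2n-∧ true  false false = refl
b2n-∧ false true  true  = refl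
b2n-∧ false true  false = refl
b2n-∧ false false true  = refl
b2n-∧ false false false = refl

corner≡scaled : ∀ N b → corner N b ≡ N * + b2n b
corner≡scaled N true  = sym (*-identityʳ N)
corner≡scaled N false = sym (*-zeroʳ N)

complement-corner≡scaled : ∀ N b → N - corner N b ≡ N * + b2n (not b)
complement-corner≡scaled N true  = trans (+-inverseʳ N) (sym (*-zeroʳ N))
complement-corner≡scaled N false = trans (+-identityʳ N) (sym (*-identityʳ N))

module AdjacencyForm {n : ℕ} (G : Graph n) where

  A : Fin n → Fin n → ℤ
  A u v = + b2n (adj G u v)

  χ : (Fin n → Bool) → Vector ℤ n
  χ p u = + b2n (p u)

  Q : Vector ℤ n → Vector ℤ n → ℤ
  Q x y = ∑[ u < n ] ∑[ v < n ] (A u v * x u * y v)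

  Q-cong : ∀ {x x′ y y′} → x ≗ x′ → y ≗ y′ → Q x y ≡ Q x′ y′
  Q-cong x≗x′ y≗y′ =
    sum-cong-≗ λ u → sum-cong-≗ λ v → cong₂ (λ a b → A u v * a * b) (x≗x′ u) (y≗y′ v)

  Q-linearˡ : ∀ a b x x′ y → Q (λ u → a * x u + b * x′ u) y ≡ a * Q x y + b * Q x′ y
  Q-linearˡ a b x x′ y =
    trans (sum-cong-≗ λ u → sum-cong-≗ λ v → distrib (A u v) a b (x u) (x′ u) (y v))
          (∑∑-linear a b (λ u v → A u v * x u * y v) (λ u v → A u v * x′ u * y v))
    where
    distrib : ∀ c a b x x′ y → c * (a * x + b * x′) * y ≡ a * (c * x * y) + b * (c * x′ * y)
    distrib = solve-∀

  Q-linearʳ : ∀ a b x y y′ → Q x (λ v → a * y v + b * y′ v) ≡ a * Q x y + b * Q x y′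
  Q-linearʳ a b x y y′ =
    trans (sum-cong-≗ λ u → sum-cong-≗ λ v → distrib (A u v) a b (x u) (y v) (y′ v))
          (∑∑-linear a b (λ u v → A u v * x u * y v) (λ u v → A u v * x u * y′ v))
    where
    distrib : ∀ c a b x y y′ → c * x * (a * y + b * y′) ≡ a * (c * x * y) + b * (c * x * y′)
    distrib = solve-∀

  Q-scale : ∀ a b x y → Q (λ u → a * x u) (λ v → b * y v) ≡ a * (b * Q x y)
  Q-scale a b x y = begin
    Q (λ u → a * x u) (λ v → b * y v)
      ≡⟨ sum-cong-≗ (λ u → sum-cong-≗ λ v → rearrange (A u v) a b (x u) (y v)) ⟩
    ∑[ u < n ] ∑[ v < n ] (a * (b * (A u v * x u * y v)))
      ≡⟨ sym (∑∑-distribˡ a (λ u v → b * (A u v * x u * y v))) ⟩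
    a * ∑[ u < n ] ∑[ v < n ] (b * (A u v * x u * y v))
      ≡⟨ cong (_*_ a) (sym (∑∑-distribˡ b (λ u v → A u v * x u * y v))) ⟩
    a * (b * Q x y) ∎
    where
    open ≡-Reasoning
    rearrange : ∀ c a b x y → c * (a * x) * (b * y) ≡ a * (b * (c * x * y))
    rearrange = solve-∀

  Q-comm : ∀ x y → Q x y ≡ Q y x
  Q-comm x y = trans (∑-comm (λ u v → A u v * x u * y v))
                     (sum-cong-≗ λ v → sum-cong-≗ λ u → transpose u v)
    where
    swap : ∀ a x y → a * x * y ≡ a * y * x
    swap = solve-∀
    transpose : ∀ u v → A u v * x u * y v ≡ A v u * y v * x u
    transpose u v = trans (cong (λ b → + b2n b * x u * y v) (Graph.sym G u v)) (swap (A v u) (x u) (y v))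

  Q-ordPairs : ∀ p q → Q (χ p) (χ q) ≡ + ordPairs G p q
  Q-ordPairs p q = sym (begin
    + ordPairs G p q
      ≡⟨ sum-allFin n (λ u → sum (map (λ v → b2n (p u ∧ q v ∧ adj G u v)) (allFin n))) ⟩
    ∑[ u < n ] (+ sum (map (λ v → b2n (p u ∧ q v ∧ adj G u v)) (allFin n)))
      ≡⟨ sum-cong-≗ (λ u → sum-allFin n (λ v → b2n (p u ∧ q v ∧ adj G u v))) ⟩
    ∑[ u < n ] ∑[ v < n ] (+ b2n (p u ∧ q v ∧ adj G u v))
      ≡⟨ sum-cong-≗ (λ u → sum-cong-≗ λ v → sym (b2n-∧ (p u) (q v) (adj G u v))) ⟩
    Q (χ p) (χ q) ∎)
    where open ≡-Reasoning

  Q-regular : ∀ {d} → Regular d G → ∀ x → Q x (const 1ℤ) ≡ + d * ∑[ u < n ] x u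
  Q-regular {d} reg x = begin
    Q x (const 1ℤ)                       ≡⟨ sum-cong-≗ row ⟩
    ∑[ u < n ] (+ d * x u)               ≡⟨ sym (*-distribˡ-sum (+ d) x) ⟩
    + d * ∑[ u < n ] x u                 ∎
    where
    open ≡-Reasoning
    drop-one : ∀ a x → a * x * 1ℤ ≡ x * a
    drop-one = solve-∀
    row : ∀ u → ∑[ v < n ] (A u v * x u * 1ℤ) ≡ + d * x u
    row u = begin
      ∑[ v < n ] (A u v * x u * 1ℤ)   ≡⟨ sum-cong-≗ (λ v → drop-one (A u v) (x u)) ⟩
      ∑[ v < n ] (x u * A u v)         ≡⟨ sym (*-distribˡ-sum (x u) (A u)) ⟩
      x u * ∑[ v < n ] A u v           ≡⟨ cong (_*_ (x u)) (sym (sum-allFin n _)) ⟩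
      x u * + deg G u                  ≡⟨ cong (λ k → x u * + k) (reg u) ⟩
      x u * + d                        ≡⟨ *-comm (x u) (+ d) ⟩
      + d * x u                        ∎

  Φ : ℤ → Vector ℤ n → ℤ
  Φ N p = Q p (λ v → N - p v)

  Φ-cong : ∀ N {p q} → p ≗ q → Φ N p ≡ Φ N q
  Φ-cong N p≗q = Q-cong p≗q (cong (_-_ N) ∘ p≗q)

  Φ-affine : ∀ N p w → N * Φ N p ≡ p w * Φ N (p [ w ]≔ N) + (N - p w) * Φ N (p [ w ]≔ 0ℤ)
  Φ-affine N p w = begin
    N * Φ N p
      ≡⟨ ∑∑-distribˡ N (term p) ⟩
    ∑[ u < n ] ∑[ v < n ] (N * term p u v)
      ≡⟨ sum-cong-≗ (λ u → sum-cong-≗ λ v → term-affine u v) ⟩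
    ∑[ u < n ] ∑[ v < n ] (p w * term (p [ w ]≔ N) u v + (N - p w) * term (p [ w ]≔ 0ℤ) u v)
      ≡⟨ ∑∑-linear (p w) (N - p w) (term (p [ w ]≔ N)) (term (p [ w ]≔ 0ℤ)) ⟩
    p w * Φ N (p [ w ]≔ N) + (N - p w) * Φ N (p [ w ]≔ 0ℤ) ∎
    where
    open ≡-Reasoning
    term : Vector ℤ n → Fin n → Fin n → ℤ
    term q u v = A u v * q u * (N - q v)
    diagonal : ∀ x N → N * (0ℤ * x * (N - x)) ≡ x * (0ℤ * N * (N - N)) + (N - x) * (0ℤ * 0ℤ * (N - 0ℤ))
    diagonal = solve-∀
    row : ∀ a x y N → N * (a * x * (N - y)) ≡ x * (a * N * (N - y)) + (N - x) * (a * 0ℤ * (N - y))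
    row = solve-∀
    column : ∀ a x y N → N * (a * x * (N - y)) ≡ y * (a * x * (N - N)) + (N - y) * (a * x * (N - 0ℤ))
    column = solve-∀
    elsewhere : ∀ a x y z N → N * (a * x * (N - y)) ≡ z * (a * x * (N - y)) + (N - z) * (a * x * (N - y))
    elsewhere = solve-∀
    term-affine : ∀ u v → N * term p u v ≡ p w * term (p [ w ]≔ N) u v + (N - p w) * term (p [ w ]≔ 0ℤ) u v
    term-affine u v with u ≟ w | v ≟ w
    ... | yes refl | yes refl  -- the only term quadratic in p w; it vanishes as G has no loops
      rewrite []≔-updates p u N | []≔-updates p u 0ℤ | irrefl G u = diagonal (p u) N
    ... | yes refl | no v≢u
      rewrite []≔-updates p u N | []≔-updates p u 0ℤ | []≔-minimal p u N v≢u | []≔-minimal p u 0ℤ v≢u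
      = row (A u v) (p u) (p v) N
    ... | no u≢v | yes refl
      rewrite []≔-updates p v N | []≔-updates p v 0ℤ | []≔-minimal p v N u≢v | []≔-minimal p v 0ℤ u≢v
      = column (A u v) (p u) (p v) N
    ... | no u≢w | no v≢w
      rewrite []≔-minimal p w N u≢w | []≔-minimal p w 0ℤ u≢w
            | []≔-minimal p w N v≢w | []≔-minimal p w 0ℤ v≢w
      = elsewhere (A u v) (p u) (p v) (p w) N

  Φ-corner : ∀ N b → Φ N (corner N ∘ b) ≡ N * (N * + ordPairs G b (not ∘ b))
  Φ-corner N b = begin
    Φ N (corner N ∘ b)
      ≡⟨ Q-cong (corner≡scaled N ∘ b) (complement-corner≡scaled N ∘ b) ⟩
    Q (λ u → N * χ b u) (λ v → N * χ (not ∘ b) v)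
      ≡⟨ Q-scale N N (χ b) (χ (not ∘ b)) ⟩
    N * (N * Q (χ b) (χ (not ∘ b)))
      ≡⟨ cong (λ k → N * (N * k)) (Q-ordPairs b (not ∘ b)) ⟩
    N * (N * + ordPairs G b (not ∘ b)) ∎
    where open ≡-Reasoning

  Φ≤mc : ∀ N ⦃ _ : Positive N ⦄ p → InBox N p → Φ N p ≤ N * (N * + mc G)
  Φ≤mc N p box = begin
    Φ N p                               ≤⟨ proj₂ rounded ⟩
    Φ N (corner N ∘ b)                  ≡⟨ Φ-corner N b ⟩
    N * (N * + ordPairs G b (not ∘ b))
      ≤⟨ *-monoˡ-≤-nonNeg N (*-monoˡ-≤-nonNeg N (+≤+ (ordPairs-complement≤mc G b))) ⟩
    N * (N * + mc G)                    ∎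
    where
    open ≤-Reasoning
    open Rounding N (Φ N) (Φ-cong N) (Φ-affine N)
    rounded : ∃[ b ] Φ N p ≤ Φ N (corner N ∘ b)
    rounded = ∃corner≥ p box
    b : Fin n → Bool
    b = proj₁ rounded
    instance
      N≥0 : NonNegative N
      N≥0 = nonNegative (positive⇒0≤ N)

  Q-ones : ∀ {d} → Regular d G → Q (const 1ℤ) (const 1ℤ) ≡ + d * + n
  Q-ones {d} reg = trans (Q-regular reg (const 1ℤ)) (cong (_*_ (+ d)) (∑-ones n))

  twiceEdges-regular : ∀ {d} → Regular d G → + twiceEdges G ≡ + d * + n
  twiceEdges-regular reg = trans (sym (Q-ordPairs (const true) (const true))) (Q-ones reg)

  Φ-biased : ∀ {d} → Regular d G → ∀ N a b (S : Subset n) →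
    Φ N (λ v → a + b * χ (inS S) v) ≡
    a * (N - a) * (+ d * + n) + (b * (N - a) - a * b) * (+ d * + ∣ S ∣) - b * b * + twiceEdgesIn G S
  Φ-biased {d} reg N a b S = begin
    Φ N (λ v → a + b * x v)
      ≡⟨ Q-cong (λ u → as-combinationˡ a b (x u)) (λ v → as-combinationʳ N a b (x v)) ⟩
    Q (λ u → a * 1ℤ + b * x u) y
      ≡⟨ Q-linearˡ a b 𝟙 x y ⟩
    a * Q 𝟙 y + b * Q x y
      ≡⟨ cong₂ (λ k l → a * k + b * l)
               (Q-linearʳ (N - a) (- b) 𝟙 𝟙 x) (Q-linearʳ (N - a) (- b) x 𝟙 x) ⟩
    a * ((N - a) * Q 𝟙 𝟙 + - b * Q 𝟙 x) + b * ((N - a) * Q x 𝟙 + - b * Q x x)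
      ≡⟨ cong₂ (λ k l → a * ((N - a) * k + - b * l) + b * ((N - a) * Q x 𝟙 + - b * Q x x))
               (Q-ones reg) Q𝟙x ⟩
    a * ((N - a) * (+ d * + n) + - b * ds) + b * ((N - a) * Q x 𝟙 + - b * Q x x)
      ≡⟨ cong₂ (λ k l → a * ((N - a) * (+ d * + n) + - b * ds) + b * ((N - a) * k + - b * l))
               Qx𝟙 (Q-ordPairs (inS S) (inS S)) ⟩
    a * ((N - a) * (+ d * + n) + - b * ds) + b * ((N - a) * ds + - b * t)
      ≡⟨ collect a b N (+ d * + n) ds t ⟩
    a * (N - a) * (+ d * + n) + (b * (N - a) - a * b) * ds - b * b * t ∎
    where
    open ≡-Reasoning
    𝟙 x y : Vector ℤ n
    𝟙 = const 1ℤ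
    x = χ (inS S)
    y v = (N - a) * 1ℤ + - b * x v
    ds t : ℤ
    ds = + d * + ∣ S ∣
    t = + twiceEdgesIn G S
    Qx𝟙 : Q x 𝟙 ≡ ds
    Qx𝟙 = trans (Q-regular reg x) (cong (_*_ (+ d)) (∑-count S))
    Q𝟙x : Q 𝟙 x ≡ ds
    Q𝟙x = trans (Q-comm 𝟙 x) Qx𝟙
    as-combinationˡ : ∀ a b x → a + b * x ≡ a * 1ℤ + b * x
    as-combinationˡ = solve-∀
    as-combinationʳ : ∀ N a b x → N - (a + b * x) ≡ (N - a) * 1ℤ + - b * x
    as-combinationʳ = solve-∀
    collect : ∀ a b N E ds t →
      a * ((N - a) * E + - b * ds) + b * ((N - a) * ds + - b * t) ≡
      a * (N - a) * E + (b * (N - a) - a * b) * ds - b * b * t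
    collect = solve-∀

biasedTowards : ∀ {n} → Subset n → Vector ℤ n
biasedTowards {n} S v = (+ n - + ∣ S ∣) + + n * + b2n (inS S v)

biasedTowards-inBox : ∀ {n} (S : Subset n) → InBox (+ n + + n) (biasedTowards S)
biasedTowards-inBox {n} S v =
  +-mono-≤ (i≤j⇒0≤j-i (+≤+ (∣p∣≤n S))) (proj₁ scaled) ,
  +-mono-≤ (i-j≤i (+ n) (+ ∣ S ∣)) (proj₂ scaled)
  where
  scaled : InInterval (+ n) (+ n * + b2n (inS S v))
  scaled = subst (InInterval (+ n)) (corner≡scaled (+ n) (inS S v)) (corner-inInterval (+≤+ Nat.z≤n) (inS S v))

lemma4p5 : ∀ (n d : ℕ) .{{_ : NonZero n}} (G : Graph n) → Regular d G → (S : Subset n) →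
    + ∣ S ∣ * + ∣ S ∣ * + d - + n * + twiceEdgesIn G S ≤ + n * fourSp G
lemma4p5 n@(Nat.suc _) d G reg S = *-cancelˡ-≤-pos _ _ (+ n) (begin
  + n * (s * s * + d - + n * t)
    ≡⟨ expand-lhs (+ n) s (+ d) t ⟩
  Φ-value - K
    ≡⟨ cong (_- K) (sym (Φ-biased reg N (+ n - s) (+ n) S)) ⟩
  Φ N (biasedTowards S) - K
    ≤⟨ +-monoˡ-≤ (- K) (Φ≤mc N (biasedTowards S) (biasedTowards-inBox S)) ⟩
  N * (N * + mc G) - K
    ≡⟨ expand-rhs (+ n) (+ mc G) (+ d) ⟩
  + n * (+ n * (+ 4 * + mc G - + d * + n))
    ≡⟨ cong₂ (λ m e → + n * (+ n * (m - e))) (sym (pos-* 4 (mc G))) (sym (twiceEdges-regular reg)) ⟩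
  + n * (+ n * fourSp G) ∎)
  where
  open AdjacencyForm G
  open ≤-Reasoning
  s t N K Φ-value : ℤ
  s = + ∣ S ∣
  t = + twiceEdgesIn G S
  N = + n + + n
  K = + n * (+ n * (+ d * + n))
  Φ-value = (+ n - s) * (N - (+ n - s)) * (+ d * + n) + (+ n * (N - (+ n - s)) - (+ n - s) * + n) * (+ d * s)
          - + n * + n * t
  expand-lhs : ∀ n s d t → n * (s * s * d - n * t) ≡
    (n - s) * ((n + n) - (n - s)) * (d * n) + (n * ((n + n) - (n - s)) - (n - s) * n) * (d * s) - n * n * t
    - n * (n * (d * n))
  expand-lhs = solve-∀
  expand-rhs : ∀ n M d → (n + n) * ((n + n) * M) - n * (n * (d * n)) ≡ n * (n * (+ 4 * M - d * n))
  expand-rhs = solve-∀
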